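{- Let $b\ge1$, let $f\in\mathcal{M}^b$ with set-array representation $(A_1,\ldots,A_b)$, and suppose $f$ is not the constant $0$ function (so $A_1\neq\emptyset$). Let $f^*\in\mathcal{M}^b$ be the element with set-array representation $(A_1,\emptyset,\ldots,\emptyset)$. Then $d(f^*)\ge d(f)$, and the inequality is strict if ($b\ge2$ and) $A_2\neq\emptyset$.
   Context: $\mathbb{N}=\{0,1,2,\ldots\}$, $X+Y=\{x+y:x\in X,y\in Y\}$, $X+\emptyset=\emptyset$. $\mathcal{M}^b$ is the set of functions $f:\mathbb{N}\to\{0,\ldots,b\}$ with finite support; the set-array representation of $f$ is $(A_1,\ldots,A_b)$ with $A_i=\{a:f(a)\ge i\}$, which determines $f$. The sum of $f,g\in\mathcal{M}^b$ with set arrays $(A_i),(B_i)$ is the element with set array $(A_1+B_1,\ldots,A_b+B_b)$. $g\in\mathcal{M}^b$ is a divisor of $f$ if $f=g+h$ for some $h\in\mathcal{M}^b$; $d(f)$ (for $f$ not identically $0$) is the number of divisors of $f$. -}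

module Defs where

open import Data.Nat using (ℕ; zero; suc; _+_; _≤_; _<_; _⊓_)
open import Data.Nat.Properties using (≤-trans; m⊓n≤n)
open import Data.Product using (Σ; ∃; _×_; _,_; proj₁)
open import Data.List using (List; length)
open import Data.List.Relation.Unary.All using (All)
open import Data.List.Relation.Unary.Any using (Any)
open import Data.List.Relation.Unary.AllPairs using (AllPairs)
open import Relation.Binary.PropositionalEquality using (_≡_)
open import Relation.Nullary using (¬_)
open import Function using (_⇔_)

record M (b : ℕ) : Set where
  constructor mk
  field
    fn      : ℕ → ℕ
    bounded : ∀ x → fn x ≤ b
    finSupp : ∃ λ N → ∀ x → N ≤ x → fn x ≡ 0
open M public

-- membership in the i-th set of the set-array representation: A_i = {a : f(a) ≥ i}
_∈A[_]_ : ∀ {b} → ℕ → ℕ → M b → Set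
a ∈A[ i ] f = i ≤ fn f a

_≈M_ : ∀ {b} → M b → M b → Set
f ≈M g = ∀ x → fn f x ≡ fn g x

IsSum : ∀ {b} → M b → M b → M b → Set
IsSum {b} f g h = ∀ i → 1 ≤ i → i ≤ b → ∀ x →
  (x ∈A[ i ] f) ⇔ (∃ λ a → ∃ λ c → (a + c ≡ x) × (a ∈A[ i ] g) × (c ∈A[ i ] h))

Divides : ∀ {b} → M b → M b → Set
Divides {b} g f = ∃ λ (h : M b) → IsSum f g h

-- d(f) = n : the divisors of f, up to equality of functions, are exactly n in number
-- (a duplicate-free list of length n enumerating all divisors).
HasDivisorCount : ∀ {b} → M b → ℕ → Set
HasDivisorCount {b} f n = Σ (List (M b)) λ L →
  (length L ≡ n) × All (λ g → Divides g f) L ×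
  AllPairs (λ g g' → ¬ (g ≈M g')) L ×
  (∀ (g : M b) → Divides g f → Any (λ g' → g ≈M g') L)

-- f* : set array (A₁, ∅, …, ∅), i.e. f*(x) = min(f(x), 1). Needs b ≥ 1.
star : ∀ {b} → 1 ≤ b → M b → M b
star {b} 1≤b f = mk (λ x → fn f x ⊓ 1) (λ x → ≤-trans (m⊓n≤n (fn f x) 1) 1≤b)
  (proj₁ (finSupp f) , λ x N≤x → zeroMin (fn f x) (Σ.proj₂ (finSupp f) x N≤x))
  where
  zeroMin : ∀ m → m ≡ 0 → m ⊓ 1 ≡ 0
  zeroMin .zero Relation.Binary.PropositionalEquality.refl = Relation.Binary.PropositionalEquality.refl

-- If f = g + h then f* = g + h*, since both sides have first set A₁ and all other sets
-- empty; so every divisor of f divides f*.  The element δ₀ with set array ({0}, ∅, …, ∅)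
-- satisfies δ₀ + f* = f*, but δ₀ + h has empty second set, so δ₀ does not divide f once
-- A₂ ≠ ∅.  Divisors of f ≠ 0 vanish beyond the support of f, so both divisor sets are
-- finite and can be listed by filtering the vectors of values on that support.
module Submission where

open import Defs
open import Data.Nat using (ℕ; zero; suc; _+_; _≤_; _<_; _⊓_; z≤n; s≤s; _≟_; _≤?_; _<?_)
open import Data.Nat.Properties
  using (≤-refl; ≤-reflexive; ≤-trans; ≤-pred; <⇒≱; ≰⇒>; ≮⇒≥; n≮0; n<1⇒n≡0;
         m≤m+n; m+n≤o⇒m≤o; +-comm; +-mono-<; m⊓n≤m; m⊓n≤n; ⊓-glb; anyUpTo?; allUpTo?)
open import Data.Fin using (Fin; toℕ; fromℕ<)
open import Data.Fin.Properties using (toℕ≤pred[n]; toℕ-fromℕ<; toℕ-injective)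
open import Data.Vec using (Vec; []; _∷_)
open import Data.Vec.Properties using (∷-injective)
open import Data.Product using (Σ; ∃; _×_; _,_; proj₁; proj₂)
open import Data.List using (List; [_]; length; map; filter; allFin; cartesianProductWith)
open import Data.List.Properties using (length-map; length-filter; filter-notAll)
open import Data.List.Relation.Unary.Any using (Any; here; any?; satisfied)
import Data.List.Relation.Unary.All.Properties as All
open import Data.List.Relation.Unary.All using ([])
open import Data.List.Relation.Unary.AllPairs using ([]; _∷_)
import Data.List.Relation.Unary.AllPairs as AllPairs
import Data.List.Relation.Unary.AllPairs.Properties as AllPairsₚ
open import Data.List.Relation.Unary.Unique.Propositional using (Unique)
import Data.List.Relation.Unary.Unique.Propositional.Properties as Unique
open import Data.List.Membership.Propositional using (_∈_; lose)
open import Data.List.Membership.Propositional.Properties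
  using (∈-allFin; ∈-cartesianProductWith⁺; ∈-filter⁺; ∈-map⁺)
open import Data.Empty using (⊥-elim)
open import Function using (_⇔_; mk⇔; Equivalence; _∘_)
open import Relation.Binary.PropositionalEquality using (_≡_; refl; sym; trans; cong; cong₂)
open import Relation.Nullary using (¬_; Dec; yes; no)
open import Relation.Nullary.Decidable using (map′; _×-dec_; _→-dec_)
open import Relation.Unary using (Decidable)

open Equivalence using (to; from)

private
  variable
    A B : Set

≤1⇒≱2+ : ∀ {m} k → m ≤ 1 → ¬ 2 + k ≤ m
≤1⇒≱2+ k m≤1 2+k≤m = n≮0 (≤-pred (≤-trans 2+k≤m m≤1))

_⇔-dec_ : Dec A → Dec B → Dec (A ⇔ B)
a? ⇔-dec b? =
  map′ (λ (f , g) → mk⇔ f g) (λ e → to e , from e) ((a? →-dec b?) ×-dec (b? →-dec a?))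

⇔-empty : ¬ A → ¬ B → A ⇔ B
⇔-empty ¬a ¬b = mk⇔ (⊥-elim ∘ ¬a) (⊥-elim ∘ ¬b)

module _ {P : ℕ → Set} (P? : Decidable P) (K : ℕ) where

  all?-cofinite : (∀ x → K ≤ x → P x) → Dec (∀ x → P x)
  all?-cofinite P-beyond = map′ extend (λ P-all {x} _ → P-all x) (allUpTo? P? K)
    where
    extend : (∀ {x} → x < K → P x) → ∀ x → P x
    extend P-below x with x <? K
    ... | yes x<K = P-below x<K
    ... | no x≮K = P-beyond x (≮⇒≥ x≮K)

  any?-bounded : (∀ x → P x → x < K) → Dec (∃ P)
  any?-bounded P⇒<K =
    map′ (λ (x , _ , px) → x , px) (λ (x , px) → x , P⇒<K x px , px) (anyUpTo? P? K)

allVecs : ∀ k n → List (Vec (Fin k) n)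
allVecs k zero = [ [] ]
allVecs k (suc n) = cartesianProductWith _∷_ (allFin k) (allVecs k n)

∈-allVecs : ∀ {k n} (v : Vec (Fin k) n) → v ∈ allVecs k n
∈-allVecs [] = here refl
∈-allVecs (d ∷ v) = ∈-cartesianProductWith⁺ _∷_ (∈-allFin d) (∈-allVecs v)

allVecs-unique : ∀ k n → Unique (allVecs k n)
allVecs-unique k zero = [] ∷ []
allVecs-unique k (suc n) =
  Unique.cartesianProductWith⁺ _∷_ ∷-injective (Unique.allFin⁺ k) (allVecs-unique k n)

module _ {b : ℕ} where

  VanishesFrom : ℕ → M b → Set
  VanishesFrom N g = ∀ x → N ≤ x → fn g x ≡ 0

  InSumset : ℕ → M b → M b → ℕ → Set
  InSumset i G H x = ∃ λ a → ∃ λ c → (a + c ≡ x) × (a ∈A[ i ] G) × (c ∈A[ i ] H)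

  ≈-sym : {g g' : M b} → g ≈M g' → g' ≈M g
  ≈-sym e x = sym (e x)

  vecFn : ∀ {n} → Vec (Fin (suc b)) n → ℕ → ℕ
  vecFn [] x = 0
  vecFn (d ∷ v) zero = toℕ d
  vecFn (d ∷ v) (suc x) = vecFn v x

  vecFn-≤ : ∀ {n} (v : Vec (Fin (suc b)) n) x → vecFn v x ≤ b
  vecFn-≤ [] x = z≤n
  vecFn-≤ (d ∷ v) zero = toℕ≤pred[n] d
  vecFn-≤ (d ∷ v) (suc x) = vecFn-≤ v x

  vecFn-vanishes : ∀ {n} (v : Vec (Fin (suc b)) n) x → n ≤ x → vecFn v x ≡ 0
  vecFn-vanishes [] x n≤x = refl
  vecFn-vanishes (d ∷ v) (suc x) (s≤s n≤x) = vecFn-vanishes v x n≤x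

  fromVec : ∀ {n} → Vec (Fin (suc b)) n → M b
  fromVec {n} v = mk (vecFn v) (vecFn-≤ v) (n , vecFn-vanishes v)

  fromVec-vanishesFrom : ∀ {n} (v : Vec (Fin (suc b)) n) → VanishesFrom n (fromVec v)
  fromVec-vanishesFrom = vecFn-vanishes

  fromVec-injective : ∀ {n} {u v : Vec (Fin (suc b)) n} → fromVec u ≈M fromVec v → u ≡ v
  fromVec-injective {u = []} {[]} e = refl
  fromVec-injective {u = d ∷ u} {d' ∷ v} e =
    cong₂ _∷_ (toℕ-injective (e 0)) (fromVec-injective (e ∘ suc))

  restrict : (g : ℕ → ℕ) → (∀ x → g x ≤ b) → ∀ n → Vec (Fin (suc b)) n
  restrict g g≤b zero = []
  restrict g g≤b (suc n) = fromℕ< (s≤s (g≤b 0)) ∷ restrict (g ∘ suc) (g≤b ∘ suc) n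

  vecFn-restrict : ∀ g g≤b {n} x → x < n → vecFn (restrict g g≤b n) x ≡ g x
  vecFn-restrict g g≤b zero (s≤s _) = toℕ-fromℕ< (s≤s (g≤b 0))
  vecFn-restrict g g≤b (suc x) (s≤s x<n) = vecFn-restrict (g ∘ suc) (g≤b ∘ suc) x x<n

  toVec : M b → ∀ n → Vec (Fin (suc b)) n
  toVec g = restrict (fn g) (bounded g)

  ≈-fromVec-toVec : ∀ {N} (g : M b) → VanishesFrom N g → g ≈M fromVec (toVec g N)
  ≈-fromVec-toVec {N} g g-vanishes x with x <? N
  ... | yes x<N = sym (vecFn-restrict (fn g) (bounded g) x x<N)
  ... | no x≮N =
    trans (g-vanishes x (≮⇒≥ x≮N)) (sym (vecFn-vanishes (toVec g N) x (≮⇒≥ x≮N)))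

  ∈A-below : ∀ {N i x} (g : M b) → VanishesFrom N g → 1 ≤ i → x ∈A[ i ] g → x < N
  ∈A-below {x = x} g g-vanishes 1≤i x∈ =
    ≰⇒> λ N≤x → n≮0 (≤-trans 1≤i (≤-trans x∈ (≤-reflexive (g-vanishes x N≤x))))

  vanishesFrom-if-A₁-below : ∀ {N} {g : M b} → (∀ x → x ∈A[ 1 ] g → x < N) → VanishesFrom N g
  vanishesFrom-if-A₁-below A₁-below x N≤x =
    n<1⇒n≡0 (≰⇒> λ x∈ → <⇒≱ (A₁-below x x∈) N≤x)

  isSum-comm : ∀ {F G H : M b} → IsSum F G H → IsSum F H G
  isSum-comm {G = G} {H} s i 1≤i i≤b x =
    mk⇔ (swap {G} {H} ∘ to (s i 1≤i i≤b x)) (from (s i 1≤i i≤b x) ∘ swap {H} {G})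
    where
    swap : ∀ {G' H'} → InSumset i G' H' x → InSumset i H' G' x
    swap (a , c , a+c≡x , a∈ , c∈) = c , a , trans (+-comm c a) a+c≡x , c∈ , a∈

  isSum-resp-≈ : ∀ {F G G' H H' : M b} → G ≈M G' → H ≈M H' → IsSum F G H → IsSum F G' H'
  isSum-resp-≈ {G = G} {G'} {H} {H'} eG eH s i 1≤i i≤b x =
    mk⇔ (transport {G} {G'} {H} {H'} eG eH ∘ to (s i 1≤i i≤b x))
        (from (s i 1≤i i≤b x) ∘
         transport {G'} {G} {H'} {H} (≈-sym {G} {G'} eG) (≈-sym {H} {H'} eH))
    where
    transport : ∀ {K K' L L' : M b} → K ≈M K' → L ≈M L' → InSumset i K L x → InSumset i K' L' x
    transport eK eL (a , c , a+c≡x , a∈ , c∈) =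
      a , c , a+c≡x , ≤-trans a∈ (≤-reflexive (eK a)) , ≤-trans c∈ (≤-reflexive (eL c))

  divides-resp-≈ : ∀ {F G G' : M b} → G ≈M G' → Divides G F → Divides G' F
  divides-resp-≈ {F} {G} {G'} e (h , s) = h , isSum-resp-≈ {F} {G} {G'} {h} {h} e (λ _ → refl) s

  summand-vanishesFrom : ∀ {N c} {F G H : M b} → 1 ≤ b → VanishesFrom N F → IsSum F G H →
                         c ∈A[ 1 ] H → VanishesFrom N G
  summand-vanishesFrom {c = c} {F} {G} 1≤b F-vanishes s c∈ =
    vanishesFrom-if-A₁-below {g = G} λ a a∈ → m+n≤o⇒m≤o (suc a)
      (∈A-below F F-vanishes ≤-refl (from (s 1 ≤-refl 1≤b (a + c)) (a , c , refl , a∈ , c∈)))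

  module _ {N : ℕ} {F G H : M b} (F-vanishes : VanishesFrom N F)
           (G-vanishes : VanishesFrom N G) (H-vanishes : VanishesFrom N H) where

    inSumset? : ∀ j x → Dec (InSumset (suc j) G H x)
    inSumset? j x = any?-bounded (λ a → any?-bounded (summands? a) N (c-below a)) N a-below
      where
      Summands : ℕ → ℕ → Set
      Summands a c = (a + c ≡ x) × (a ∈A[ suc j ] G) × (c ∈A[ suc j ] H)
      summands? : ∀ a c → Dec (Summands a c)
      summands? a c = (a + c ≟ x) ×-dec (suc j ≤? fn G a) ×-dec (suc j ≤? fn H c)
      c-below : ∀ a c → Summands a c → c < N
      c-below a c (_ , _ , c∈) = ∈A-below H H-vanishes (s≤s z≤n) c∈
      a-below : ∀ a → (∃ λ c → Summands a c) → a < N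
      a-below a (c , _ , a∈ , _) = ∈A-below G G-vanishes (s≤s z≤n) a∈

    isSum? : Dec (IsSum F G H)
    isSum? = all?-cofinite atLevel? (suc b) λ i b<i _ i≤b → ⊥-elim (<⇒≱ b<i i≤b)
      where
      beyond-sums : ∀ j x → N + N ≤ x → (x ∈A[ suc j ] F) ⇔ InSumset (suc j) G H x
      beyond-sums j x N+N≤x = ⇔-empty
        (λ x∈ → <⇒≱ (∈A-below F F-vanishes (s≤s z≤n) x∈) (≤-trans (m≤m+n N N) N+N≤x))
        (λ { (a , c , refl , a∈ , c∈) → <⇒≱ (+-mono-< (∈A-below G G-vanishes (s≤s z≤n) a∈)
                                                      (∈A-below H H-vanishes (s≤s z≤n) c∈)) N+N≤x })
      atLevel? : ∀ i → Dec (1 ≤ i → i ≤ b → ∀ x → (x ∈A[ i ] F) ⇔ InSumset i G H x)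
      atLevel? zero = yes λ ()
      atLevel? (suc j) = map′ (λ p _ → p) (λ p → p (s≤s z≤n))
        ((suc j ≤? b) →-dec
         all?-cofinite (λ x → (suc j ≤? fn F x) ⇔-dec inSumset? j x) (N + N) (beyond-sums j))

  module DivisorsOf (1≤b : 1 ≤ b) {N : ℕ} (F : M b) (F-vanishes : VanishesFrom N F)
                    (F-nonzero : ∃ λ x → x ∈A[ 1 ] F) where

    divisor-vanishesFrom : ∀ {G H} → IsSum F G H → VanishesFrom N G × VanishesFrom N H
    divisor-vanishesFrom {G} {H} s
      with a , c , _ , a∈ , c∈ ← to (s 1 ≤-refl 1≤b (proj₁ F-nonzero)) (proj₂ F-nonzero) =
      summand-vanishesFrom {F = F} {G} {H} 1≤b F-vanishes s c∈ ,
      summand-vanishesFrom {F = F} {H} {G} 1≤b F-vanishes (isSum-comm {F} {G} {H} s) a∈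

    toVec-divides : ∀ G → VanishesFrom N G → Divides G F → Divides (fromVec (toVec G N)) F
    toVec-divides G G-vanishes =
      divides-resp-≈ {F} {G} {fromVec (toVec G N)} (≈-fromVec-toVec G G-vanishes)

    divides? : ∀ {G} → VanishesFrom N G → Dec (Divides G F)
    divides? {G} G-vanishes = map′ (λ p → let (w , s) = satisfied p in fromVec w , s) complete
      (any? (λ w → isSum? {N} {F} {G} {fromVec w} F-vanishes G-vanishes (fromVec-vanishesFrom w))
            (allVecs (suc b) N))
      where
      complete : Divides G F → Any (λ w → IsSum F G (fromVec w)) (allVecs (suc b) N)
      complete (H , s) = lose (∈-allVecs (toVec H N))
        (isSum-resp-≈ {F} {G} {G} {H} {fromVec (toVec H N)} (λ _ → refl)
                       (≈-fromVec-toVec H (proj₂ (divisor-vanishesFrom {G} {H} s))) s)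

    fromVec-divides? : Decidable (λ (v : Vec (Fin (suc b)) N) → Divides (fromVec v) F)
    fromVec-divides? v = divides? {fromVec v} (fromVec-vanishesFrom v)

    hasDivisorCount-filter : (cs : List (Vec (Fin (suc b)) N)) → Unique cs →
                             (∀ v → Divides (fromVec v) F → v ∈ cs) →
                             HasDivisorCount F (length (filter fromVec-divides? cs))
    hasDivisorCount-filter cs cs-unique cs-complete =
      map fromVec ds , length-map fromVec ds , All.map⁺ (All.all-filter fromVec-divides? cs) ,
      AllPairsₚ.map⁺ (AllPairs.map (_∘ fromVec-injective)
                                   (Unique.filter⁺ fromVec-divides? cs-unique)) ,
      covers
      where
      ds = filter fromVec-divides? cs
      covers : ∀ g → Divides g F → Any (g ≈M_) (map fromVec ds)
      covers g g∣F@(h , s) =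
        lose (∈-map⁺ fromVec (∈-filter⁺ fromVec-divides? (cs-complete w w∣F) w∣F))
             (≈-fromVec-toVec g g-vanishes)
        where
        g-vanishes = proj₁ (divisor-vanishesFrom {g} {h} s)
        w = toVec g N
        w∣F = toVec-divides g g-vanishes g∣F

module _ {b : ℕ} (1≤b : 1 ≤ b) where

  ∈A₁-star : ∀ {F : M b} {x} → x ∈A[ 1 ] star 1≤b F ⇔ x ∈A[ 1 ] F
  ∈A₁-star {F} {x} =
    mk⇔ (λ x∈ → ≤-trans x∈ (m⊓n≤m (fn F x) 1)) (λ x∈ → ⊓-glb x∈ ≤-refl)

  star-≤1 : ∀ (F : M b) x → fn (star 1≤b F) x ≤ 1
  star-≤1 F x = m⊓n≤n (fn F x) 1

  star-vanishesFrom : ∀ {N} {F : M b} → VanishesFrom N F → VanishesFrom N (star 1≤b F)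
  star-vanishesFrom F-vanishes x N≤x = cong (_⊓ 1) (F-vanishes x N≤x)

  divides-star : ∀ {F G : M b} → Divides G F → Divides G (star 1≤b F)
  divides-star {F} {G} (h , s) = star 1≤b h , isSum-star
    where
    isSum-star : IsSum (star 1≤b F) G (star 1≤b h)
    isSum-star (suc zero) 1≤i i≤b x = mk⇔
      (λ x∈ → let (a , c , a+c≡x , a∈ , c∈) = to (s 1 1≤i i≤b x) (to (∈A₁-star {F}) x∈)
              in a , c , a+c≡x , a∈ , from (∈A₁-star {h}) c∈)
      (λ (a , c , a+c≡x , a∈ , c∈) →
        from (∈A₁-star {F})
             (from (s 1 1≤i i≤b x) (a , c , a+c≡x , a∈ , to (∈A₁-star {h}) c∈)))
    isSum-star (suc (suc k)) _ _ x = ⇔-empty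
      (≤1⇒≱2+ k (star-≤1 F x))
      (λ (_ , c , _ , _ , c∈) → ≤1⇒≱2+ k (star-≤1 h c) c∈)

  δ₀ : M b
  δ₀ = mk (λ { zero → 1 ; (suc _) → 0 })
          (λ { zero → 1≤b ; (suc _) → z≤n })
          (1 , λ { (suc _) _ → refl })

  δ₀-≤1 : ∀ x → fn δ₀ x ≤ 1
  δ₀-≤1 zero = ≤-refl
  δ₀-≤1 (suc x) = z≤n

  δ₀-vanishesFrom : ∀ {N} → 0 < N → VanishesFrom N δ₀
  δ₀-vanishesFrom 0<N zero N≤0 = ⊥-elim (<⇒≱ 0<N N≤0)
  δ₀-vanishesFrom 0<N (suc x) _ = refl

  δ₀-divides : ∀ {F : M b} → (∀ x → fn F x ≤ 1) → Divides δ₀ F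
  δ₀-divides {F} F≤1 = F , isSum-δ₀
    where
    isSum-δ₀ : IsSum F δ₀ F
    isSum-δ₀ (suc zero) _ _ x = mk⇔ (λ x∈ → 0 , x , refl , ≤-refl , x∈)
      (λ { (zero , c , refl , _ , c∈) → c∈ ; (suc a , c , _ , () , _) })
    isSum-δ₀ (suc (suc k)) _ _ x = ⇔-empty
      (≤1⇒≱2+ k (F≤1 x))
      (λ (a , _ , _ , a∈ , _) → ≤1⇒≱2+ k (δ₀-≤1 a) a∈)

  δ₀-∤ : ∀ {F : M b} → (∃ λ x → x ∈A[ 2 ] F) → ¬ Divides δ₀ F
  δ₀-∤ {F} (x , x∈) (h , s)
    with a , _ , _ , a∈ , _ ← to (s 2 (s≤s z≤n) (≤-trans x∈ (bounded F x)) x) x∈ =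
    ≤1⇒≱2+ 0 (δ₀-≤1 a) a∈

mainTheorem18 : (b : ℕ) (1≤b : 1 ≤ b) (f : M b) →
    (∃ λ x → x ∈A[ 1 ] f) →
    Σ ℕ λ m → Σ ℕ λ n →
      HasDivisorCount f m × HasDivisorCount (star 1≤b f) n × m ≤ n ×
      ((∃ λ x → x ∈A[ 2 ] f) → m < n)
mainTheorem18 b 1≤b f f-nonzero@(x , x∈) =
  length (filter D.fromVec-divides? divisors*) , length divisors* ,
  D.hasDivisorCount-filter divisors* divisors*-unique divisors*-complete ,
  D*.hasDivisorCount-filter (allVecs (suc b) N) (allVecs-unique (suc b) N)
    (λ v _ → ∈-allVecs v) ,
  length-filter D.fromVec-divides? divisors* ,
  λ A₂≢∅ → filter-notAll D.fromVec-divides? divisors* (lose δ₀ᵥ∈divisors* (δ₀ᵥ∤f A₂≢∅))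
  where
  N = proj₁ (finSupp f)
  f-vanishes : VanishesFrom N f
  f-vanishes = proj₂ (finSupp f)
  f* = star 1≤b f
  module D = DivisorsOf 1≤b f f-vanishes f-nonzero
  module D* = DivisorsOf 1≤b f* (star-vanishesFrom 1≤b {N} {f} f-vanishes)
                                (x , from (∈A₁-star 1≤b {f}) x∈)

  divisors* : List (Vec (Fin (suc b)) N)
  divisors* = filter D*.fromVec-divides? (allVecs (suc b) N)

  divisors*-unique : Unique divisors*
  divisors*-unique = Unique.filter⁺ D*.fromVec-divides? (allVecs-unique (suc b) N)

  divisors*-complete : ∀ v → Divides (fromVec v) f → v ∈ divisors*
  divisors*-complete v v∣f =
    ∈-filter⁺ D*.fromVec-divides? (∈-allVecs v) (divides-star 1≤b {f} {fromVec v} v∣f)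

  δ₀-vanishes : VanishesFrom N (δ₀ 1≤b)
  δ₀-vanishes = δ₀-vanishesFrom 1≤b (≤-trans (s≤s z≤n) (∈A-below f f-vanishes ≤-refl x∈))

  δ₀ᵥ = toVec (δ₀ 1≤b) N

  δ₀ᵥ∈divisors* : δ₀ᵥ ∈ divisors*
  δ₀ᵥ∈divisors* = ∈-filter⁺ D*.fromVec-divides? (∈-allVecs δ₀ᵥ)
    (D*.toVec-divides (δ₀ 1≤b) δ₀-vanishes (δ₀-divides 1≤b {f*} (star-≤1 1≤b f)))

  δ₀ᵥ∤f : (∃ λ x → x ∈A[ 2 ] f) → ¬ Divides (fromVec δ₀ᵥ) f
  δ₀ᵥ∤f A₂≢∅ = δ₀-∤ 1≤b {f} A₂≢∅ ∘ divides-resp-≈ {F = f} {fromVec δ₀ᵥ} {δ₀ 1≤b} δ₀ᵥ≈δ₀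
    where
    δ₀ᵥ≈δ₀ : fromVec δ₀ᵥ ≈M δ₀ 1≤b
    δ₀ᵥ≈δ₀ = ≈-sym {g = δ₀ 1≤b} {fromVec δ₀ᵥ} (≈-fromVec-toVec (δ₀ 1≤b) δ₀-vanishes)
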